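{- Let $q$ be a power of an odd prime with $q\equiv 5\pmod 8$, let $h\in\mathbb{F}_{q^2}$ with $h^2=2$, let $\varepsilon\in\{1,-1\}$ and let $P=(1,2\varepsilon,h,0)\in\mathrm{PG}(3,q^2)$. Let $v,t\in\mathbb{F}_{q^2}\setminus\mathbb{F}_q$ satisfy $F(v,t)=0$, where $F(v,t)=(v+t)^{q+1}-2(vt+(vt)^q)$. If the line through a point $P_{u,v}=(1,u,v,v^2)\in\Delta^+$ and a point $Q_{s,t}=(1,s,t,t^2)\in\Delta^-$ is a generator of $\mathcal{U}_3$ passing through $P$, then $vt-h(v+t)=0$.
   Context: $\mathcal{U}_3$ is the Hermitian surface of $\mathrm{PG}(3,q^2)$ with equation $X_1^{q+1}+2X_2^{q+1}-X_3^qX_0-X_3X_0^q=0$ (the point $P$ lies on it); a generator is a line contained in $\mathcal{U}_3$. $\Delta^+$ is the set of points $(1,u,v,v^2)$ with $u,v\in\mathbb{F}_{q^2}$, $u\neq0$, $u^{\frac{q+1}{2}}=v^q-v$ (the $\mathbb{F}_{q^2}$-rational points off the plane $X_1=0$ of the Fuhrmann–Torres curve $\mathcal{X}^+$, the image of $y^q-yz^{q-1}=x^{\frac{q+1}{2}}z^{\frac{q+1}{2}}$ under $(x,y,z)\mapsto(z^2,xz,yz,y^2)$), and $\Delta^-$ is the set of points $(1,s,t,t^2)$ with $s\neq0$, $-s^{\frac{q+1}{2}}=t^q-t$ (the analogous set for $\mathcal{X}^-$, image of $y^q-yz^{q-1}=-x^{\frac{q+1}{2}}z^{\frac{q+1}{2}}$).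 -}

module Defs where

open import Level using (0ℓ)
open import Data.Nat as ℕ using (ℕ; zero; suc)
open import Data.Nat.DivMod using (_/_)
open import Data.Fin using (Fin)
open import Data.Product using (Σ; ∃; _×_; _,_)
open import Relation.Nullary using (¬_; Dec)
open import Relation.Binary.PropositionalEquality using (_≡_)
open import Algebra.Bundles using (CommutativeRing)

record FiniteField (n : ℕ) : Set₁ where
  field
    commRing : CommutativeRing 0ℓ 0ℓ
  open CommutativeRing commRing public
  field
    1≉0     : ¬ (1# ≈ 0#)
    inverse : ∀ x → ¬ (x ≈ 0#) → ∃ λ y → (x * y) ≈ 1#
    _≟_     : ∀ x y → Dec (x ≈ y)
    enum    : Fin n → Carrier
    enum-injective  : ∀ i j → enum i ≈ enum j → i ≡ j
    enum-surjective : ∀ x → ∃ λ i → enum i ≈ x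

  _^_ : Carrier → ℕ → Carrier
  x ^ zero  = 1#
  x ^ suc k = x * (x ^ k)

  2# : Carrier
  2# = 1# + 1#

open import Data.Nat.Primality using (Prime)
IsOddPrimePower : ℕ → Set
IsOddPrimePower q = ∃ λ p → ∃ λ k → Prime p × (p ℕ.% 2 ≡ 1) × (1 ℕ.≤ k) × (q ≡ p ℕ.^ k)

module Geometry (q : ℕ) (F : FiniteField (q ℕ.* q)) where
  open FiniteField F

  -- homogeneous coordinates (X0,X1,X2,X3)
  Vec4 : Set
  Vec4 = Carrier × Carrier × Carrier × Carrier

  _≈₄_ : Vec4 → Vec4 → Set
  (a0 , a1 , a2 , a3) ≈₄ (b0 , b1 , b2 , b3) = (a0 ≈ b0) × (a1 ≈ b1) × (a2 ≈ b2) × (a3 ≈ b3)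

  comb : Carrier → Vec4 → Carrier → Vec4 → Vec4
  comb l (a0 , a1 , a2 , a3) m (b0 , b1 , b2 , b3) =
    (l * a0 + m * b0 , l * a1 + m * b1 , l * a2 + m * b2 , l * a3 + m * b3)

  herm : Vec4 → Carrier
  herm (x0 , x1 , x2 , x3) =
    x1 ^ (q ℕ.+ 1) + 2# * (x2 ^ (q ℕ.+ 1)) - (x3 ^ q) * x0 - x3 * (x0 ^ q)

  OnU3 : Vec4 → Set
  OnU3 X = herm X ≈ 0#

  IsGenerator : Vec4 → Vec4 → Set
  IsGenerator A B = ∀ l m → OnU3 (comb l A m B)

  OnLine : Vec4 → Vec4 → Vec4 → Set
  OnLine X A B = ∃ λ l → ∃ λ m → comb l A m B ≈₄ X

  pt : Carrier → Carrier → Vec4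
  pt a b = (1# , a , b , b * b)

  InFq : Carrier → Set
  InFq x = (x ^ q) ≈ x

  InΔ⁺ : Carrier → Carrier → Set
  InΔ⁺ u v = ¬ (u ≈ 0#) × ((u ^ ((q ℕ.+ 1) / 2)) ≈ (v ^ q) - v)

  InΔ⁻ : Carrier → Carrier → Set
  InΔ⁻ s t = ¬ (s ≈ 0#) × ((- (s ^ ((q ℕ.+ 1) / 2))) ≈ (t ^ q) - t)

  Fpoly : Carrier → Carrier → Carrier
  Fpoly v t = ((v + t) ^ (q ℕ.+ 1)) - 2# * (v * t + ((v * t) ^ q))

{-# OPTIONS --safe #-}
module Submission where

open import Defs
open import Data.Nat as ℕ using (ℕ)
open import Data.Product using (_,_)
open import Data.Sum using (_⊎_)
open import Relation.Nullary using (¬_)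
open import Relation.Binary.PropositionalEquality using (_≡_)
open import Level using (0ℓ)
open import Algebra.Bundles using (CommutativeRing)
import Algebra.Properties.Group as GroupProperties
import Algebra.Solver.Ring.NaturalCoefficients.Default as NaturalCoefficientsSolver
import Relation.Binary.Reasoning.Setoid as SetoidReasoning

-- The point P has X3 = 0, so writing P = l·P_{u,v} + m·Q_{s,t} gives l + m = 1,
-- l v + m t = h and l v² + m t² = 0; multiplying the second equation by v + t
-- and using the other two yields h (v + t) = v t.

module SecantRelation (R : CommutativeRing 0ℓ 0ℓ) where
  open CommutativeRing R
  open NaturalCoefficientsSolver commutativeSemiring
  open SetoidReasoning setoid

  weighted-sum-*-sum : ∀ l m v t →
    (l * v + m * t) * (v + t) ≈ (l * (v * v) + m * (t * t)) + v * t * (l + m)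
  weighted-sum-*-sum = solve 4 (λ l m v t → (l :* v :+ m :* t) :* (v :+ t)
    := (l :* (v :* v) :+ m :* (t :* t)) :+ v :* t :* (l :+ m)) refl

  secant-relation : ∀ {l m v t h} → l + m ≈ 1# → l * v + m * t ≈ h →
    l * (v * v) + m * (t * t) ≈ 0# → h * (v + t) ≈ v * t
  secant-relation {l} {m} {v} {t} {h} l+m≈1 lv+mt≈h lv²+mt²≈0 = begin
    h * (v + t)                                    ≈⟨ *-congʳ (sym lv+mt≈h) ⟩
    (l * v + m * t) * (v + t)                      ≈⟨ weighted-sum-*-sum l m v t ⟩
    (l * (v * v) + m * (t * t)) + v * t * (l + m)  ≈⟨ +-cong lv²+mt²≈0 (*-congˡ l+m≈1) ⟩
    0# + v * t * 1#                                ≈⟨ +-identityˡ _ ⟩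
    v * t * 1#                                     ≈⟨ *-identityʳ _ ⟩
    v * t                                          ∎

module _ (q : ℕ) (F : FiniteField (q ℕ.* q)) where
  open FiniteField F
  open Geometry q F
  open SecantRelation commRing
  open GroupProperties +-group using (x≈y⇒x∙y⁻¹≈ε)

  onLine⇒vt-h[v+t]≈0 : ∀ {a h u v s t} → OnLine (1# , a , h , 0#) (pt u v) (pt s t) →
    v * t - h * (v + t) ≈ 0#
  onLine⇒vt-h[v+t]≈0 (l , m , l1+m1≈1 , _ , lv+mt≈h , lv²+mt²≈0) =
    x≈y⇒x∙y⁻¹≈ε (sym (secant-relation l+m≈1 lv+mt≈h lv²+mt²≈0))
    where
    l+m≈1 : l + m ≈ 1#
    l+m≈1 = trans (sym (+-cong (*-identityʳ _) (*-identityʳ _))) l1+m1≈1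

mainTheorem4 : (q : ℕ) → IsOddPrimePower q → q ℕ.% 8 ≡ 5 →
  (F : FiniteField (q ℕ.* q)) →
  let open FiniteField F
      open Geometry q F
  in (h : Carrier) → (h * h) ≈ 2# →
     (ε : Carrier) → (ε ≈ 1#) ⊎ (ε ≈ - 1#) →
     (u v s t : Carrier) →
     ¬ InFq v → ¬ InFq t → Fpoly v t ≈ 0# →
     InΔ⁺ u v → InΔ⁻ s t →
     IsGenerator (pt u v) (pt s t) →
     OnLine (1# , 2# * ε , h , 0#) (pt u v) (pt s t) →
     (v * t - h * (v + t)) ≈ 0#
mainTheorem4 q _ _ F _ _ _ _ _ _ _ _ _ _ _ _ _ _ P∈PQ = onLine⇒vt-h[v+t]≈0 q F P∈PQ
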